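{- Let $\Gamma$ be an inductive relator for $T$ that respects $\Sigma$, let $\precsim=(\precsim_{\mathcal T},\precsim_{\mathcal V})$ be applicative $\Gamma$-similarity and $\precsim^H=(\precsim^H_{\mathcal T},\precsim^H_{\mathcal V})$ its Howe extension. If $M,N$ are closed terms with $\emptyset\vdash M\,\precsim^H_{\mathcal T}\,N$ and $M\Downarrow_n X$, then $X\ \Gamma(\precsim^H_{\mathcal V})\ [\![N]\!]$, where $\precsim^H_{\mathcal V}$ is restricted to closed values.
   Context: A signature $\Sigma$: operation symbols with finite arities. An $\omega$CPPO is a poset with least element $\bot$ and lubs of $\omega$-chains; continuous = monotone and lub-preserving. $T$ is a monad on sets (unit $\eta$, bind $\gg\!=$) with each $TX$ an $\omega$CPPO, bind continuous in both arguments, and each $\sigma$ of arity $k$ interpreted as a continuous $\sigma^T:(TX)^k\to TX$. Terms/values: $M,N ::= \mathsf{return}\,V\mid VW\mid M\ \mathsf{to}\ x.N\mid\sigma(M_1,\dots,M_k)$, $V,W::=x\mid\lambda x.M$. Judgments $M\Downarrow_n X$ for closed $M$, $X\in T\mathcal V_0$: $M\Downarrow_0\bot$; $\mathsf{return}\,V\Downarrow_{n+1}\eta(V)$; $M[V/x]\Downarrow_n X\Rightarrow(\lambda x.M)V\Downarrow_{n+1}X$; $M\Downarrow_nX$, $N[V/x]\Downarrow_nY_V$ (all closed $V$) $\Rightarrow(M\ \mathsf{to}\ x.N)\Downarrow_{n+1}X\gg\!=(V\mapsto Y_V)$; $M_i\Downarrow_nX_i\Rightarrow\sigma(\bar M)\Downarrow_{n+1}\sigma^T(\bar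 X)$. $[\![M]\!]$ is the lub of the $\omega$-chain of the $X$ with $M\Downarrow_n X$. Relator for $T$: $R\subseteq X\times Y\mapsto\Gamma R\subseteq TX\times TY$ with $=_{TX}\subseteq\Gamma(=_X)$, $\Gamma S\circ\Gamma R\subseteq\Gamma(S\circ R)$, $\Gamma((f\times g)^{ -1}R)=(Tf\times Tg)^{ -1}\Gamma R$, monotone, $x\,R\,y\Rightarrow\eta(x)\,\Gamma R\,\eta(y)$, and ($x\,R\,y\Rightarrow f(x)\,\Gamma S\,g(y)$) implies ($u\,\Gamma R\,v\Rightarrow(u\gg\!=f)\,\Gamma S\,(v\gg\!=g)$). Inductive: $\bot\,\Gamma R\,v$ for all $v$, and $(\forall n.\,u_n\,\Gamma R\,v)\Rightarrow\bigsqcup_n u_n\,\Gamma R\,v$ for $\omega$-chains. Respects $\Sigma$: $u_i\,\Gamma R\,v_i$ ($\forall i$) $\Rightarrow\sigma^T(\bar u)\,\Gamma R\,\sigma^T(\bar v)$. Applicative $\Gamma$-simulation: closed $(R_{\mathcal T},R_{\mathcal V})$ with $M\,R_{\mathcal T}\,N\Rightarrow[\![M]\!]\,\Gamma R_{\mathcal V}\,[\![N]\!]$ and $V\,R_{\mathcal V}\,W\Rightarrow VU\,R_{\mathcal T}\,WU$ for all closed $U$; applicative similarity is the largest one. Open relations are sets of triples $\bar x\vdash M\,R\,N$ with free variables in the finite set $\bar x$; the open extension $R^\circ$ of a closed $R$ relates $\bar x\vdash M,N$ iff $M[\bar V/\bar x]\,R\,N[\bar V/\bar x]$ for all closed values $\bar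 V$. The compatible refinement $\widehat S$ of a $\lambda$-term relation $S$ is defined by: $\bar x\vdash x\,\widehat S\,x$ ($x\in\bar x$); $\bar x\cup\{x\}\vdash M\,S\,N\Rightarrow\bar x\vdash\lambda x.M\,\widehat S\,\lambda x.N$; $\bar x\vdash V\,S\,W\Rightarrow\bar x\vdash\mathsf{return}\,V\,\widehat S\,\mathsf{return}\,W$; $\bar x\vdash V\,S\,V'$, $\bar x\vdash W\,S\,W'\Rightarrow\bar x\vdash VW\,\widehat S\,V'W'$; $\bar x\vdash M\,S\,M'$, $\bar x\cup\{x\}\vdash N\,S\,N'\Rightarrow\bar x\vdash M\ \mathsf{to}\ x.N\,\widehat S\,M'\ \mathsf{to}\ x.N'$; $\bar x\vdash M_i\,S\,N_i$ ($\forall i$) $\Rightarrow\bar x\vdash\sigma(\bar M)\,\widehat S\,\sigma(\bar N)$. The Howe extension $R^H$ of a closed relation $R$ is the least $\lambda$-term relation $S$ such that $\bar x\vdash M\,S\,N$ iff there is $L$ with $\bar x\vdash M\,\widehat S\,L$ and $\bar x\vdash L\,R^\circ\,N$ (on both terms and values). -}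

module Defs where

open import Level using (Level; 0ℓ; Setω) renaming (suc to lsuc)
open import Data.Nat using (ℕ; zero; suc)
open import Data.Fin using (Fin; zero; suc)
open import Data.Product using (Σ; _×_; _,_)
open import Function using (_∘_)
open import Relation.Binary using (REL)
open import Relation.Binary.PropositionalEquality using (_≡_)

record Signature : Set₁ where
  field
    Op : Set
    ar : Op → ℕ

record ωCPPO (A : Set) : Set₁ where
  field
    _⊑_       : A → A → Set
    ⊑-refl    : ∀ {x} → x ⊑ x
    ⊑-trans   : ∀ {x y z} → x ⊑ y → y ⊑ z → x ⊑ z
    ⊑-antisym : ∀ {x y} → x ⊑ y → y ⊑ x → x ≡ y
    ⊥         : A
    ⊥-least   : ∀ {x} → ⊥ ⊑ x
    ⨆         : (c : ℕ → A) → (∀ n → c n ⊑ c (suc n)) → A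
    ⨆-upper   : ∀ c p n → c n ⊑ ⨆ c p
    ⨆-least   : ∀ c p {x} → (∀ n → c n ⊑ x) → ⨆ c p ⊑ x

-- Syntax (well-scoped de Bruijn: a term in scope n has free variables
-- among n variables; closed = scope 0)

module Syntax (Sig : Signature) where
  open Signature Sig

  mutual
    data Val (n : ℕ) : Set where
      var : Fin n → Val n
      lam : Tm (suc n) → Val n

    data Tm (n : ℕ) : Set where
      ret : Val n → Tm n
      app : Val n → Val n → Tm n
      to  : Tm n → Tm (suc n) → Tm n       -- M to x. N
      op  : (o : Op) → (Fin (ar o) → Tm n) → Tm n

  ext : ∀ {n m} → (Fin n → Fin m) → Fin (suc n) → Fin (suc m)
  ext ρ zero    = zero
  ext ρ (suc i) = suc (ρ i)

  mutual
    renV : ∀ {n m} → (Fin n → Fin m) → Val n → Val m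
    renV ρ (var x) = var (ρ x)
    renV ρ (lam M) = lam (renT (ext ρ) M)

    renT : ∀ {n m} → (Fin n → Fin m) → Tm n → Tm m
    renT ρ (ret V)   = ret (renV ρ V)
    renT ρ (app V W) = app (renV ρ V) (renV ρ W)
    renT ρ (to M N)  = to (renT ρ M) (renT (ext ρ) N)
    renT ρ (op o Ms) = op o (λ i → renT ρ (Ms i))

  exts : ∀ {n m} → (Fin n → Val m) → Fin (suc n) → Val (suc m)
  exts σ zero    = var zero
  exts σ (suc i) = renV suc (σ i)

  mutual
    subV : ∀ {n m} → (Fin n → Val m) → Val n → Val m
    subV σ (var x) = σ x
    subV σ (lam M) = lam (subT (exts σ) M)

    subT : ∀ {n m} → (Fin n → Val m) → Tm n → Tm m
    subT σ (ret V)   = ret (subV σ V)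
    subT σ (app V W) = app (subV σ V) (subV σ W)
    subT σ (to M N)  = to (subT σ M) (subT (exts σ) N)
    subT σ (op o Ms) = op o (λ i → subT σ (Ms i))

  single : Val 0 → Fin 1 → Val 0
  single V zero = V

  _[_] : Tm 1 → Val 0 → Tm 0
  M [ V ] = subT (single V) M

record ContMonad (Sig : Signature) : Set₁ where
  open Signature Sig
  field
    T     : Set → Set
    η     : ∀ {X} → X → T X
    bind  : ∀ {X Y} → T X → (X → T Y) → T Y
    unitˡ : ∀ {X Y} (x : X) (f : X → T Y) → bind (η x) f ≡ f x
    unitʳ : ∀ {X} (u : T X) → bind u η ≡ u
    assoc : ∀ {X Y Z} (u : T X) (f : X → T Y) (g : Y → T Z) →
            bind (bind u f) g ≡ bind u (λ x → bind (f x) g)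
    cppo  : (X : Set) → ωCPPO (T X)

  _⊑_ : ∀ {X} → T X → T X → Set
  _⊑_ {X} = ωCPPO._⊑_ (cppo X)

  ⨆ : ∀ {X} (c : ℕ → T X) → (∀ n → c n ⊑ c (suc n)) → T X
  ⨆ {X} = ωCPPO.⨆ (cppo X)

  field
    bind-mono₁ : ∀ {X Y} (f : X → T Y) {u v : T X} → u ⊑ v → bind u f ⊑ bind v f
    bind-lub₁  : ∀ {X Y} (f : X → T Y) (c : ℕ → T X) (p : ∀ n → c n ⊑ c (suc n)) →
                 bind (⨆ c p) f ≡ ⨆ (λ n → bind (c n) f) (λ n → bind-mono₁ f (p n))
    bind-mono₂ : ∀ {X Y} (u : T X) {f g : X → T Y} → (∀ x → f x ⊑ g x) → bind u f ⊑ bind u g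
    bind-lub₂  : ∀ {X Y} (u : T X) (fs : ℕ → X → T Y) (p : ∀ n x → fs n x ⊑ fs (suc n) x) →
                 bind u (λ x → ⨆ (λ n → fs n x) (λ n → p n x))
                   ≡ ⨆ (λ n → bind u (fs n)) (λ n → bind-mono₂ u (p n))
    opT     : ∀ {X} (o : Op) → (Fin (ar o) → T X) → T X
    opT-mono : ∀ {X} (o : Op) {us vs : Fin (ar o) → T X} → (∀ i → us i ⊑ vs i) → opT o us ⊑ opT o vs
    opT-lub  : ∀ {X} (o : Op) (cs : ℕ → Fin (ar o) → T X) (p : ∀ n i → cs n i ⊑ cs (suc n) i) →
               opT o (λ i → ⨆ (λ n → cs n i) (λ n → p n i))
                 ≡ ⨆ (λ n → opT o (cs n)) (λ n → opT-mono o (p n))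

  ⊥ : ∀ {X} → T X
  ⊥ {X} = ωCPPO.⊥ (cppo X)

  Tmap : ∀ {X Y} → (X → Y) → T X → T Y
  Tmap f u = bind u (η ∘ f)

module Semantics (Sig : Signature) (𝕋 : ContMonad Sig) where
  open Signature Sig
  open Syntax Sig
  open ContMonad 𝕋

  data _⇓[_]_ : Tm 0 → ℕ → T (Val 0) → Set where
    ⇓zero : ∀ {M} → M ⇓[ 0 ] ⊥
    ⇓ret  : ∀ {n V} → ret V ⇓[ suc n ] η V
    ⇓app  : ∀ {n M V X} → (M [ V ]) ⇓[ n ] X → app (lam M) V ⇓[ suc n ] X
    ⇓to   : ∀ {n M N X} {Y : Val 0 → T (Val 0)} →
            M ⇓[ n ] X → (∀ V → (N [ V ]) ⇓[ n ] Y V) → to M N ⇓[ suc n ] bind X Y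
    ⇓op   : ∀ {n o Ms} {Xs : Fin (ar o) → T (Val 0)} →
            (∀ i → Ms i ⇓[ n ] Xs i) → op o Ms ⇓[ suc n ] opT o Xs

  -- the (unique) X with M ⇓[ n ] X, computed
  ev : ℕ → Tm 0 → T (Val 0)
  ev zero    M                 = ⊥
  ev (suc n) (ret V)           = η V
  ev (suc n) (app (var ()) W)
  ev (suc n) (app (lam M) W)   = ev n (M [ W ])
  ev (suc n) (to M N)          = bind (ev n M) (λ V → ev n (N [ V ]))
  ev (suc n) (op o Ms)         = opT o (λ i → ev n (Ms i))

  private
    module C = ωCPPO (cppo (Val 0))

  ev-chain : ∀ n M → ev n M ⊑ ev (suc n) M
  ev-chain zero    M = C.⊥-least
  ev-chain (suc n) (ret V) = C.⊑-refl
  ev-chain (suc n) (app (var ()) W)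
  ev-chain (suc n) (app (lam M) W) = ev-chain n (M [ W ])
  ev-chain (suc n) (to M N) =
    C.⊑-trans (bind-mono₁ _ (ev-chain n M))
              (bind-mono₂ _ (λ V → ev-chain n (N [ V ])))
  ev-chain (suc n) (op o Ms) = opT-mono o (λ i → ev-chain n (Ms i))

  ⟦_⟧ : Tm 0 → T (Val 0)
  ⟦ M ⟧ = ⨆ (λ n → ev n M) (λ n → ev-chain n M)

module Relators (Sig : Signature) (𝕋 : ContMonad Sig) where
  open Signature Sig
  open ContMonad 𝕋

  RelLift : Setω
  RelLift = ∀ {ℓ} {X Y : Set} → REL X Y ℓ → REL (T X) (T Y) ℓ

  record IsRelator (Γ : RelLift) : Setω where
    field
      rel-refl : ∀ {X : Set} (u : T X) → Γ (_≡_ {A = X}) u u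
      rel-comp : ∀ {ℓ₁ ℓ₂} {X Y Z : Set} (R : REL X Y ℓ₁) (S : REL Y Z ℓ₂) {u : T X} {w : T Z} →
                 Σ (T Y) (λ v → Γ R u v × Γ S v w) →
                 Γ (λ x z → Σ Y (λ y → R x y × S y z)) u w
      rel-inv₁ : ∀ {ℓ} {X X' Y Y' : Set} (f : X → X') (g : Y → Y') (R : REL X' Y' ℓ) {u : T X} {v : T Y} →
                 Γ (λ x y → R (f x) (g y)) u v → Γ R (Tmap f u) (Tmap g v)
      rel-inv₂ : ∀ {ℓ} {X X' Y Y' : Set} (f : X → X') (g : Y → Y') (R : REL X' Y' ℓ) {u : T X} {v : T Y} →
                 Γ R (Tmap f u) (Tmap g v) → Γ (λ x y → R (f x) (g y)) u v
      rel-mono : ∀ {ℓ₁ ℓ₂} {X Y : Set} (R : REL X Y ℓ₁) (S : REL X Y ℓ₂) →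
                 (∀ {x y} → R x y → S x y) → ∀ {u v} → Γ R u v → Γ S u v
      rel-η    : ∀ {ℓ} {X Y : Set} (R : REL X Y ℓ) {x : X} {y : Y} → R x y → Γ R (η x) (η y)
      rel-bind : ∀ {ℓ₁ ℓ₂} {X Y X' Y' : Set} (R : REL X Y ℓ₁) (S : REL X' Y' ℓ₂)
                 (f : X → T X') (g : Y → T Y') →
                 (∀ {x y} → R x y → Γ S (f x) (g y)) →
                 ∀ {u v} → Γ R u v → Γ S (bind u f) (bind v g)

  record IsInductive (Γ : RelLift) : Setω where
    field
      ind-⊥   : ∀ {ℓ} {X Y : Set} (R : REL X Y ℓ) (v : T Y) → Γ R ⊥ v
      ind-lub : ∀ {ℓ} {X Y : Set} (R : REL X Y ℓ) (c : ℕ → T X) (p : ∀ n → c n ⊑ c (suc n)) (v : T Y) →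
                (∀ n → Γ R (c n) v) → Γ R (⨆ c p) v

  RespectsΣ : RelLift → Setω
  RespectsΣ Γ = ∀ {ℓ} {X Y : Set} (R : REL X Y ℓ) (o : Op)
                (us : Fin (ar o) → T X) (vs : Fin (ar o) → T Y) →
                (∀ i → Γ R (us i) (vs i)) → Γ R (opT o us) (opT o vs)

module Similarity (Sig : Signature) (𝕋 : ContMonad Sig)
                  (Γ : Relators.RelLift Sig 𝕋) where
  open Signature Sig
  open Syntax Sig
  open ContMonad 𝕋
  open Semantics Sig 𝕋

  IsSimulation : REL (Tm 0) (Tm 0) 0ℓ → REL (Val 0) (Val 0) 0ℓ → Set
  IsSimulation RT RV =
    (∀ {M N} → RT M N → Γ RV ⟦ M ⟧ ⟦ N ⟧) ×
    (∀ {V W} → RV V W → ∀ (U : Val 0) → RT (app V U) (app W U))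

  -- applicative similarity = the largest simulation (union of all)
  _≾T_ : REL (Tm 0) (Tm 0) (lsuc 0ℓ)
  M ≾T N = Σ (REL (Tm 0) (Tm 0) 0ℓ) λ RT → Σ (REL (Val 0) (Val 0) 0ℓ) λ RV →
           IsSimulation RT RV × RT M N

  _≾V_ : REL (Val 0) (Val 0) (lsuc 0ℓ)
  V ≾V W = Σ (REL (Tm 0) (Tm 0) 0ℓ) λ RT → Σ (REL (Val 0) (Val 0) 0ℓ) λ RV →
           IsSimulation RT RV × RV V W

  _≾T°_ : ∀ {n} → REL (Tm n) (Tm n) (lsuc 0ℓ)
  _≾T°_ {n} M N = ∀ (ρ : Fin n → Val 0) → subT ρ M ≾T subT ρ N

  _≾V°_ : ∀ {n} → REL (Val n) (Val n) (lsuc 0ℓ)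
  _≾V°_ {n} V W = ∀ (ρ : Fin n → Val 0) → subV ρ V ≾V subV ρ W

  data CompV {ℓ} (ST : ∀ n → REL (Tm n) (Tm n) ℓ) (SV : ∀ n → REL (Val n) (Val n) ℓ)
       : ∀ n → REL (Val n) (Val n) ℓ where
    c-var : ∀ {n} (x : Fin n) → CompV ST SV n (var x) (var x)
    c-lam : ∀ {n M N} → ST (suc n) M N → CompV ST SV n (lam M) (lam N)

  data CompT {ℓ} (ST : ∀ n → REL (Tm n) (Tm n) ℓ) (SV : ∀ n → REL (Val n) (Val n) ℓ)
       : ∀ n → REL (Tm n) (Tm n) ℓ where
    c-ret : ∀ {n V W} → SV n V W → CompT ST SV n (ret V) (ret W)
    c-app : ∀ {n V V' W W'} → SV n V V' → SV n W W' → CompT ST SV n (app V W) (app V' W')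
    c-to  : ∀ {n M M' N N'} → ST n M M' → ST (suc n) N N' → CompT ST SV n (to M N) (to M' N')
    c-op  : ∀ {n} (o : Op) {Ms Ns : Fin (ar o) → Tm n} →
            (∀ i → ST n (Ms i) (Ns i)) → CompT ST SV n (op o Ms) (op o Ns)

  -- Howe extension: least S with  S = Ŝ ; (≾)°
  mutual
    data HoweT : ∀ n → REL (Tm n) (Tm n) (lsuc 0ℓ) where
      howeT : ∀ {n M L N} → CompT HoweT HoweV n M L → L ≾T° N → HoweT n M N

    data HoweV : ∀ n → REL (Val n) (Val n) (lsuc 0ℓ) where
      howeV : ∀ {n V L W} → CompV HoweT HoweV n V L → L ≾V° W → HoweV n V W

-- The proof is by induction
-- on the derivation of M ⇓ₙ X, inverting the Howe extension once: M is
-- compatibly related to some L with L ≾ N, the premises of ⇓ give (by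
-- induction, and by the relator laws) a Γ(≾ᴴ)-link from X to ⟦L⟧, and the
-- link is extended to ⟦N⟧ by composing with Γ(≾) and using ≾ᴴ ; ≾ ⊆ ≾ᴴ.
module Submission where

open import Defs
open import Data.Nat using (ℕ; zero; suc; _≤′_; _⊔_; ≤′-refl; ≤′-step)
open import Data.Nat.Properties using (≤⇒≤′; m≤m⊔n; m≤n⊔m)
open import Data.Fin using (Fin; zero; suc)
open import Data.Product using (Σ; _×_; _,_; proj₁; proj₂)
open import Relation.Binary.PropositionalEquality using (_≡_; refl; sym; cong; subst)

module SyntacticEquality (Sig : Signature) where
  open Signature Sig
  open Syntax Sig

  -- Syntactic identity of terms, comparing the arguments of an operation
  -- pointwise.  It plays the role of ≡ in all substitution laws below.
  mutual
    data _≈V_ : ∀ {n} → Val n → Val n → Set where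
      ≈var : ∀ {n} (x : Fin n) → var x ≈V var x
      ≈lam : ∀ {n} {M N : Tm (suc n)} → M ≈T N → lam M ≈V lam N

    data _≈T_ : ∀ {n} → Tm n → Tm n → Set where
      ≈ret : ∀ {n} {V W : Val n} → V ≈V W → ret V ≈T ret W
      ≈app : ∀ {n} {V V' W W' : Val n} → V ≈V V' → W ≈V W' → app V W ≈T app V' W'
      ≈to  : ∀ {n} {M M' : Tm n} {N N'} → M ≈T M' → N ≈T N' → to M N ≈T to M' N'
      ≈op  : ∀ {n} o {Ms Ns : Fin (ar o) → Tm n} → (∀ i → Ms i ≈T Ns i) → op o Ms ≈T op o Ns

  mutual
    ≈V-refl : ∀ {n} (V : Val n) → V ≈V V
    ≈V-refl (var x) = ≈var x
    ≈V-refl (lam M) = ≈lam (≈T-refl M)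

    ≈T-refl : ∀ {n} (M : Tm n) → M ≈T M
    ≈T-refl (ret V)   = ≈ret (≈V-refl V)
    ≈T-refl (app V W) = ≈app (≈V-refl V) (≈V-refl W)
    ≈T-refl (to M N)  = ≈to (≈T-refl M) (≈T-refl N)
    ≈T-refl (op o Ms) = ≈op o (λ i → ≈T-refl (Ms i))

  mutual
    ≈V-sym : ∀ {n} {V W : Val n} → V ≈V W → W ≈V V
    ≈V-sym (≈var x) = ≈var x
    ≈V-sym (≈lam m) = ≈lam (≈T-sym m)

    ≈T-sym : ∀ {n} {M N : Tm n} → M ≈T N → N ≈T M
    ≈T-sym (≈ret v)    = ≈ret (≈V-sym v)
    ≈T-sym (≈app v w)  = ≈app (≈V-sym v) (≈V-sym w)
    ≈T-sym (≈to m n)   = ≈to (≈T-sym m) (≈T-sym n)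
    ≈T-sym (≈op o ms)  = ≈op o (λ i → ≈T-sym (ms i))

  mutual
    ≈V-trans : ∀ {n} {U V W : Val n} → U ≈V V → V ≈V W → U ≈V W
    ≈V-trans (≈var x) (≈var .x) = ≈var x
    ≈V-trans (≈lam m) (≈lam m') = ≈lam (≈T-trans m m')

    ≈T-trans : ∀ {n} {L M N : Tm n} → L ≈T M → M ≈T N → L ≈T N
    ≈T-trans (≈ret v)   (≈ret v')     = ≈ret (≈V-trans v v')
    ≈T-trans (≈app v w) (≈app v' w')  = ≈app (≈V-trans v v') (≈V-trans w w')
    ≈T-trans (≈to m n)  (≈to m' n')   = ≈to (≈T-trans m m') (≈T-trans n n')
    ≈T-trans (≈op o ms) (≈op .o ms')  = ≈op o (λ i → ≈T-trans (ms i) (ms' i))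

  _≈S_ : ∀ {n m} → (Fin n → Val m) → (Fin n → Val m) → Set
  σ ≈S σ' = ∀ i → σ i ≈V σ' i

  mutual
    renV-cong : ∀ {n m} (ρ : Fin n → Fin m) {V W} → V ≈V W → renV ρ V ≈V renV ρ W
    renV-cong ρ (≈var x) = ≈var (ρ x)
    renV-cong ρ (≈lam m) = ≈lam (renT-cong (ext ρ) m)

    renT-cong : ∀ {n m} (ρ : Fin n → Fin m) {M N} → M ≈T N → renT ρ M ≈T renT ρ N
    renT-cong ρ (≈ret v)   = ≈ret (renV-cong ρ v)
    renT-cong ρ (≈app v w) = ≈app (renV-cong ρ v) (renV-cong ρ w)
    renT-cong ρ (≈to m n)  = ≈to (renT-cong ρ m) (renT-cong (ext ρ) n)
    renT-cong ρ (≈op o ms) = ≈op o (λ i → renT-cong ρ (ms i))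

  exts-cong : ∀ {n m} {σ σ' : Fin n → Val m} → σ ≈S σ' → exts σ ≈S exts σ'
  exts-cong h zero    = ≈var zero
  exts-cong h (suc i) = renV-cong suc (h i)

  mutual
    subV-cong : ∀ {n m} {σ σ' : Fin n → Val m} → σ ≈S σ' → {V W : Val n} → V ≈V W →
                subV σ V ≈V subV σ' W
    subV-cong h (≈var x) = h x
    subV-cong h (≈lam m) = ≈lam (subT-cong (exts-cong h) m)

    subT-cong : ∀ {n m} {σ σ' : Fin n → Val m} → σ ≈S σ' → {M N : Tm n} → M ≈T N →
                subT σ M ≈T subT σ' N
    subT-cong h (≈ret v)   = ≈ret (subV-cong h v)
    subT-cong h (≈app v w) = ≈app (subV-cong h v) (subV-cong h w)
    subT-cong h (≈to m n)  = ≈to (subT-cong h m) (subT-cong (exts-cong h) n)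
    subT-cong h (≈op o ms) = ≈op o (λ i → subT-cong h (ms i))

  ext-fusion : ∀ {n m k} {ρ : Fin m → Fin k} {ρ' : Fin n → Fin m} {ρ'' : Fin n → Fin k} →
               (∀ i → ρ (ρ' i) ≡ ρ'' i) → ∀ i → ext ρ (ext ρ' i) ≡ ext ρ'' i
  ext-fusion h zero    = refl
  ext-fusion h (suc i) = cong suc (h i)

  mutual
    renV-renV : ∀ {n m k} (ρ : Fin m → Fin k) (ρ' : Fin n → Fin m) (ρ'' : Fin n → Fin k) →
                (∀ i → ρ (ρ' i) ≡ ρ'' i) → (V : Val n) → renV ρ (renV ρ' V) ≈V renV ρ'' V
    renV-renV ρ ρ' ρ'' h (var x) rewrite h x = ≈var (ρ'' x)
    renV-renV ρ ρ' ρ'' h (lam M) = ≈lam (renT-renT (ext ρ) (ext ρ') (ext ρ'') (ext-fusion h) M)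

    renT-renT : ∀ {n m k} (ρ : Fin m → Fin k) (ρ' : Fin n → Fin m) (ρ'' : Fin n → Fin k) →
                (∀ i → ρ (ρ' i) ≡ ρ'' i) → (M : Tm n) → renT ρ (renT ρ' M) ≈T renT ρ'' M
    renT-renT ρ ρ' ρ'' h (ret V)   = ≈ret (renV-renV ρ ρ' ρ'' h V)
    renT-renT ρ ρ' ρ'' h (app V W) = ≈app (renV-renV ρ ρ' ρ'' h V) (renV-renV ρ ρ' ρ'' h W)
    renT-renT ρ ρ' ρ'' h (to M N)  =
      ≈to (renT-renT ρ ρ' ρ'' h M) (renT-renT (ext ρ) (ext ρ') (ext ρ'') (ext-fusion h) N)
    renT-renT ρ ρ' ρ'' h (op o Ms) = ≈op o (λ i → renT-renT ρ ρ' ρ'' h (Ms i))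

  exts-ext-fusion : ∀ {n m k} {σ : Fin m → Val k} {ρ : Fin n → Fin m} {υ : Fin n → Val k} →
                    (∀ i → σ (ρ i) ≈V υ i) → ∀ i → exts σ (ext ρ i) ≈V exts υ i
  exts-ext-fusion h zero    = ≈var zero
  exts-ext-fusion h (suc i) = renV-cong suc (h i)

  mutual
    subV-renV : ∀ {n m k} (σ : Fin m → Val k) (ρ : Fin n → Fin m) (υ : Fin n → Val k) →
                (∀ i → σ (ρ i) ≈V υ i) → (V : Val n) → subV σ (renV ρ V) ≈V subV υ V
    subV-renV σ ρ υ h (var x) = h x
    subV-renV σ ρ υ h (lam M) =
      ≈lam (subT-renT (exts σ) (ext ρ) (exts υ) (exts-ext-fusion h) M)

    subT-renT : ∀ {n m k} (σ : Fin m → Val k) (ρ : Fin n → Fin m) (υ : Fin n → Val k) →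
                (∀ i → σ (ρ i) ≈V υ i) → (M : Tm n) → subT σ (renT ρ M) ≈T subT υ M
    subT-renT σ ρ υ h (ret V)   = ≈ret (subV-renV σ ρ υ h V)
    subT-renT σ ρ υ h (app V W) = ≈app (subV-renV σ ρ υ h V) (subV-renV σ ρ υ h W)
    subT-renT σ ρ υ h (to M N)  =
      ≈to (subT-renT σ ρ υ h M) (subT-renT (exts σ) (ext ρ) (exts υ) (exts-ext-fusion h) N)
    subT-renT σ ρ υ h (op o Ms) = ≈op o (λ i → subT-renT σ ρ υ h (Ms i))

  mutual
    renV-subV : ∀ {n m k} (ρ : Fin m → Fin k) (σ : Fin n → Val m) (υ : Fin n → Val k) →
                (∀ i → renV ρ (σ i) ≈V υ i) → (V : Val n) → renV ρ (subV σ V) ≈V subV υ V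
    renV-subV ρ σ υ h (var x) = h x
    renV-subV ρ σ υ h (lam M) = ≈lam (renT-subT (ext ρ) (exts σ) (exts υ) (ext-exts-fusion h) M)

    renT-subT : ∀ {n m k} (ρ : Fin m → Fin k) (σ : Fin n → Val m) (υ : Fin n → Val k) →
                (∀ i → renV ρ (σ i) ≈V υ i) → (M : Tm n) → renT ρ (subT σ M) ≈T subT υ M
    renT-subT ρ σ υ h (ret V)   = ≈ret (renV-subV ρ σ υ h V)
    renT-subT ρ σ υ h (app V W) = ≈app (renV-subV ρ σ υ h V) (renV-subV ρ σ υ h W)
    renT-subT ρ σ υ h (to M N)  =
      ≈to (renT-subT ρ σ υ h M) (renT-subT (ext ρ) (exts σ) (exts υ) (ext-exts-fusion h) N)
    renT-subT ρ σ υ h (op o Ms) = ≈op o (λ i → renT-subT ρ σ υ h (Ms i))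

    ext-exts-fusion : ∀ {n m k} {ρ : Fin m → Fin k} {σ : Fin n → Val m} {υ : Fin n → Val k} →
                      (∀ i → renV ρ (σ i) ≈V υ i) → ∀ i → renV (ext ρ) (exts σ i) ≈V exts υ i
    ext-exts-fusion h zero = ≈var zero
    ext-exts-fusion {ρ = ρ} {σ = σ} h (suc i) =
      ≈V-trans (renV-renV (ext ρ) suc (λ j → suc (ρ j)) (λ j → refl) (σ i))
        (≈V-trans (≈V-sym (renV-renV suc ρ (λ j → suc (ρ j)) (λ j → refl) (σ i)))
                  (renV-cong suc (h i)))

  mutual
    subV-subV : ∀ {n m k} (τ : Fin m → Val k) (σ : Fin n → Val m) (υ : Fin n → Val k) →
                (∀ i → subV τ (σ i) ≈V υ i) → (V : Val n) → subV τ (subV σ V) ≈V subV υ V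
    subV-subV τ σ υ h (var x) = h x
    subV-subV τ σ υ h (lam M) = ≈lam (subT-subT (exts τ) (exts σ) (exts υ) (exts-exts-fusion h) M)

    subT-subT : ∀ {n m k} (τ : Fin m → Val k) (σ : Fin n → Val m) (υ : Fin n → Val k) →
                (∀ i → subV τ (σ i) ≈V υ i) → (M : Tm n) → subT τ (subT σ M) ≈T subT υ M
    subT-subT τ σ υ h (ret V)   = ≈ret (subV-subV τ σ υ h V)
    subT-subT τ σ υ h (app V W) = ≈app (subV-subV τ σ υ h V) (subV-subV τ σ υ h W)
    subT-subT τ σ υ h (to M N)  =
      ≈to (subT-subT τ σ υ h M) (subT-subT (exts τ) (exts σ) (exts υ) (exts-exts-fusion h) N)
    subT-subT τ σ υ h (op o Ms) = ≈op o (λ i → subT-subT τ σ υ h (Ms i))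

    exts-exts-fusion : ∀ {n m k} {τ : Fin m → Val k} {σ : Fin n → Val m} {υ : Fin n → Val k} →
                       (∀ i → subV τ (σ i) ≈V υ i) → ∀ i → subV (exts τ) (exts σ i) ≈V exts υ i
    exts-exts-fusion h zero = ≈var zero
    exts-exts-fusion {τ = τ} {σ = σ} h (suc i) =
      ≈V-trans (subV-renV (exts τ) suc (λ j → renV suc (τ j)) (λ j → ≈V-refl _) (σ i))
        (≈V-trans (≈V-sym (renV-subV suc τ (λ j → renV suc (τ j)) (λ j → ≈V-refl _) (σ i)))
                  (renV-cong suc (h i)))

  exts-identity : ∀ {n} {σ : Fin n → Val n} → σ ≈S var → exts σ ≈S var
  exts-identity h zero    = ≈var zero
  exts-identity h (suc i) = renV-cong suc (h i)

  mutual
    subV-identity : ∀ {n} (σ : Fin n → Val n) → σ ≈S var → (V : Val n) → subV σ V ≈V V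
    subV-identity σ h (var x) = h x
    subV-identity σ h (lam M) = ≈lam (subT-identity (exts σ) (exts-identity h) M)

    subT-identity : ∀ {n} (σ : Fin n → Val n) → σ ≈S var → (M : Tm n) → subT σ M ≈T M
    subT-identity σ h (ret V)   = ≈ret (subV-identity σ h V)
    subT-identity σ h (app V W) = ≈app (subV-identity σ h V) (subV-identity σ h W)
    subT-identity σ h (to M N)  = ≈to (subT-identity σ h M) (subT-identity (exts σ) (exts-identity h) N)
    subT-identity σ h (op o Ms) = ≈op o (λ i → subT-identity σ h (Ms i))

  subV-closed : (σ : Fin 0 → Val 0) (V : Val 0) → subV σ V ≈V V
  subV-closed σ = subV-identity σ (λ ())

  subT-closed : (σ : Fin 0 → Val 0) (M : Tm 0) → subT σ M ≈T M
  subT-closed σ = subT-identity σ (λ ())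

  single-cong : {V W : Val 0} → V ≈V W → single V ≈S single W
  single-cong v zero = v

module DenotationEquations (Sig : Signature) (𝕋 : ContMonad Sig) where
  open Syntax Sig
  open ContMonad 𝕋
  open Semantics Sig 𝕋
  private module C = ωCPPO (cppo (Val 0))

  ≡⇒⊑ : ∀ {u v : T (Val 0)} → u ≡ v → u ⊑ v
  ≡⇒⊑ refl = C.⊑-refl

  ev-mono : ∀ {m n} → m ≤′ n → ∀ M → ev m M ⊑ ev n M
  ev-mono ≤′-refl     M = C.⊑-refl
  ev-mono (≤′-step p) M = C.⊑-trans (ev-mono p M) (ev-chain _ M)

  ev⊑⟦⟧ : ∀ n M → ev n M ⊑ ⟦ M ⟧
  ev⊑⟦⟧ n M = C.⨆-upper (λ k → ev k M) (λ k → ev-chain k M) n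

  ⟦⟧⊑ : ∀ M {u} → (∀ n → ev n M ⊑ u) → ⟦ M ⟧ ⊑ u
  ⟦⟧⊑ M = C.⨆-least _ _

  ⟦ret⟧ : ∀ V → ⟦ ret V ⟧ ≡ η V
  ⟦ret⟧ V = C.⊑-antisym (⟦⟧⊑ (ret V) below) (ev⊑⟦⟧ 1 (ret V))
    where
      below : ∀ n → ev n (ret V) ⊑ η V
      below zero    = C.⊥-least
      below (suc n) = C.⊑-refl

  ⟦app⟧ : ∀ M W → ⟦ app (lam M) W ⟧ ≡ ⟦ M [ W ] ⟧
  ⟦app⟧ M W = C.⊑-antisym (⟦⟧⊑ _ below) (⟦⟧⊑ _ (λ n → ev⊑⟦⟧ (suc n) (app (lam M) W)))
    where
      below : ∀ n → ev n (app (lam M) W) ⊑ ⟦ M [ W ] ⟧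
      below zero    = C.⊥-least
      below (suc n) = ev⊑⟦⟧ n (M [ W ])

  -- For sequencing, bind ⟦M⟧ (⟦N[-]⟧) is a double lub (continuity of bind in
  -- each argument), each of whose elements lies below an approximant of to M N.
  ⟦to⟧ : ∀ M N → ⟦ to M N ⟧ ≡ bind ⟦ M ⟧ (λ V → ⟦ N [ V ] ⟧)
  ⟦to⟧ M N = C.⊑-antisym (⟦⟧⊑ _ below) above
    where
      below : ∀ n → ev n (to M N) ⊑ bind ⟦ M ⟧ (λ V → ⟦ N [ V ] ⟧)
      below zero    = C.⊥-least
      below (suc n) = C.⊑-trans (bind-mono₁ _ (ev⊑⟦⟧ n M)) (bind-mono₂ _ (λ V → ev⊑⟦⟧ n (N [ V ])))

      approximant : ∀ n m → bind (ev n M) (λ V → ev m (N [ V ])) ⊑ ⟦ to M N ⟧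
      approximant n m =
        C.⊑-trans (bind-mono₁ _ (ev-mono (≤⇒≤′ (m≤m⊔n n m)) M))
          (C.⊑-trans (bind-mono₂ _ (λ V → ev-mono (≤⇒≤′ (m≤n⊔m n m)) (N [ V ])))
                     (ev⊑⟦⟧ (suc (n ⊔ m)) (to M N)))

      above : bind ⟦ M ⟧ (λ V → ⟦ N [ V ] ⟧) ⊑ ⟦ to M N ⟧
      above =
        C.⊑-trans (≡⇒⊑ (bind-lub₁ _ (λ n → ev n M) (λ n → ev-chain n M)))
          (C.⨆-least _ _ λ n →
            C.⊑-trans (≡⇒⊑ (bind-lub₂ (ev n M) (λ m V → ev m (N [ V ])) (λ m V → ev-chain m (N [ V ]))))
                      (C.⨆-least _ _ (approximant n)))

  ⟦op⟧ : ∀ o Ms → ⟦ op o Ms ⟧ ≡ opT o (λ i → ⟦ Ms i ⟧)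
  ⟦op⟧ o Ms = C.⊑-antisym (⟦⟧⊑ _ below) above
    where
      below : ∀ n → ev n (op o Ms) ⊑ opT o (λ i → ⟦ Ms i ⟧)
      below zero    = C.⊥-least
      below (suc n) = opT-mono o (λ i → ev⊑⟦⟧ n (Ms i))

      above : opT o (λ i → ⟦ Ms i ⟧) ⊑ ⟦ op o Ms ⟧
      above =
        C.⊑-trans (≡⇒⊑ (opT-lub o (λ n i → ev n (Ms i)) (λ n i → ev-chain n (Ms i))))
                  (C.⨆-least _ _ (λ n → ev⊑⟦⟧ (suc n) (op o Ms)))

module SimilarityProperties (Sig : Signature) (𝕋 : ContMonad Sig) (Γ : Relators.RelLift Sig 𝕋)
  (isRelator : Relators.IsRelator Sig 𝕋 Γ) (isInductive : Relators.IsInductive Sig 𝕋 Γ)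
  (respectsΣ : Relators.RespectsΣ Sig 𝕋 Γ) where
  open Syntax Sig
  open Semantics Sig 𝕋
  open Similarity Sig 𝕋 Γ
  open SyntacticEquality Sig
  open DenotationEquations Sig 𝕋
  open Relators.IsRelator isRelator
  open Relators.IsInductive isInductive

  -- Syntactic identity is a simulation: every approximant of M is Γ(≈)-related
  -- to ⟦N⟧ (by induction on the approximation index), hence so is their lub.
  ≈-approximant : ∀ k {M N : Tm 0} → M ≈T N → Γ (_≈V_ {0}) (ev k M) ⟦ N ⟧
  ≈-approximant zero m = ind-⊥ _ _
  ≈-approximant (suc k) (≈ret {W = W} v) =
    subst (Γ _≈V_ _) (sym (⟦ret⟧ W)) (rel-η _ v)
  ≈-approximant (suc k) (≈app (≈var ()) w)
  ≈-approximant (suc k) (≈app (≈lam {N = M'} m) w) =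
    subst (Γ _≈V_ _) (sym (⟦app⟧ M' _)) (≈-approximant k (subT-cong (single-cong w) m))
  ≈-approximant (suc k) (≈to {M' = M'} {N' = N'} m n) =
    subst (Γ _≈V_ _) (sym (⟦to⟧ M' N'))
      (rel-bind _≈V_ _≈V_ _ (λ V → ⟦ N' [ V ] ⟧)
        (λ v → ≈-approximant k (subT-cong (single-cong v) n)) (≈-approximant k m))
  ≈-approximant (suc k) (≈op o {Ns = Ns} ms) =
    subst (Γ _≈V_ _) (sym (⟦op⟧ o Ns)) (respectsΣ _ o _ _ (λ i → ≈-approximant k (ms i)))

  ≈-simulation : IsSimulation (_≈T_ {0}) (_≈V_ {0})
  ≈-simulation = (λ m → ind-lub _ _ _ _ (λ k → ≈-approximant k m)) , (λ v U → ≈app v (≈V-refl U))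

  ≈⇒≾T : ∀ {M N : Tm 0} → M ≈T N → M ≾T N
  ≈⇒≾T m = _ , _ , ≈-simulation , m

  ≈⇒≾V : ∀ {V W : Val 0} → V ≈V W → V ≾V W
  ≈⇒≾V v = _ , _ , ≈-simulation , v

  simulation-comp : ∀ {RT₁ RV₁ RT₂ RV₂} → IsSimulation RT₁ RV₁ → IsSimulation RT₂ RV₂ →
    IsSimulation (λ M N → Σ (Tm 0) λ P → RT₁ M P × RT₂ P N)
                 (λ V W → Σ (Val 0) λ U → RV₁ V U × RV₂ U W)
  simulation-comp {RV₁ = RV₁} {RV₂ = RV₂} (sim₁ , app₁) (sim₂ , app₂) =
    (λ { (P , a , b) → rel-comp RV₁ RV₂ (⟦ P ⟧ , sim₁ a , sim₂ b) }) ,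
    (λ { (U' , a , b) U → app U' U , app₁ a U , app₂ b U })

  ≾T-trans : ∀ {L M N} → L ≾T M → M ≾T N → L ≾T N
  ≾T-trans (_ , _ , s₁ , a) (_ , _ , s₂ , b) = _ , _ , simulation-comp s₁ s₂ , (_ , a , b)

  ≾V-trans : ∀ {U V W} → U ≾V V → V ≾V W → U ≾V W
  ≾V-trans (_ , _ , s₁ , a) (_ , _ , s₂ , b) = _ , _ , simulation-comp s₁ s₂ , (_ , a , b)

  ≾T⇒Γ : ∀ {M N} → M ≾T N → Γ _≾V_ ⟦ M ⟧ ⟦ N ⟧
  ≾T⇒Γ (RT , RV , s , m) = rel-mono RV _≾V_ (λ r → RT , RV , s , r) (proj₁ s m)

  ≾V-app : ∀ {V W} → V ≾V W → ∀ U → app V U ≾T app W U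
  ≾V-app (RT , RV , s , v) U = RT , RV , s , proj₂ s v U

  ≾T-up-to-≈ : ∀ {M M' N N' : Tm 0} → M ≈T M' → M' ≾T N' → N ≈T N' → M ≾T N
  ≾T-up-to-≈ m s n = ≾T-trans (≈⇒≾T m) (≾T-trans s (≈⇒≾T (≈T-sym n)))

  ≾V-up-to-≈ : ∀ {V V' W W' : Val 0} → V ≈V V' → V' ≾V W' → W ≈V W' → V ≾V W
  ≾V-up-to-≈ v s w = ≾V-trans (≈⇒≾V v) (≾V-trans s (≈⇒≾V (≈V-sym w)))

  ≾T°⇒≾T : ∀ {M N : Tm 0} → M ≾T° N → M ≾T N
  ≾T°⇒≾T {M} {N} s = ≾T-up-to-≈ (≈T-sym (subT-closed _ M)) (s (λ ())) (≈T-sym (subT-closed _ N))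

  ≾V°⇒≾V : ∀ {V W : Val 0} → V ≾V° W → V ≾V W
  ≾V°⇒≾V {V} {W} s = ≾V-up-to-≈ (≈V-sym (subV-closed _ V)) (s (λ ())) (≈V-sym (subV-closed _ W))

  ≾V⇒≾V° : ∀ {V W : Val 0} → V ≾V W → V ≾V° W
  ≾V⇒≾V° {V} {W} s ρ = ≾V-up-to-≈ (subV-closed ρ V) s (subV-closed ρ W)

  ≾V°-refl : ∀ {n} (V : Val n) → V ≾V° V
  ≾V°-refl V ρ = ≈⇒≾V (≈V-refl _)

  ≾V°-trans : ∀ {n} {U V W : Val n} → U ≾V° V → V ≾V° W → U ≾V° W
  ≾V°-trans a b ρ = ≾V-trans (a ρ) (b ρ)

  -- The open extension is stable under substitution and renaming: a closing
  -- substitution of subT σ L is a closing substitution of L, up to fusion.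
  ≾T°-sub : ∀ {n m} {L N : Tm n} → L ≾T° N → (σ : Fin n → Val m) → subT σ L ≾T° subT σ N
  ≾T°-sub {L = L} {N} s σ ρ =
    ≾T-up-to-≈ (subT-subT ρ σ _ (λ i → ≈V-refl _) L) (s _) (subT-subT ρ σ _ (λ i → ≈V-refl _) N)

  ≾V°-sub : ∀ {n m} {L N : Val n} → L ≾V° N → (σ : Fin n → Val m) → subV σ L ≾V° subV σ N
  ≾V°-sub {L = L} {N} s σ ρ =
    ≾V-up-to-≈ (subV-subV ρ σ _ (λ i → ≈V-refl _) L) (s _) (subV-subV ρ σ _ (λ i → ≈V-refl _) N)

  ≾T°-ren : ∀ {n m} {L N : Tm n} → L ≾T° N → (π : Fin n → Fin m) → renT π L ≾T° renT π N
  ≾T°-ren {L = L} {N} s π ρ =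
    ≾T-up-to-≈ (subT-renT ρ π _ (λ i → ≈V-refl _) L) (s _) (subT-renT ρ π _ (λ i → ≈V-refl _) N)

  ≾V°-ren : ∀ {n m} {L N : Val n} → L ≾V° N → (π : Fin n → Fin m) → renV π L ≾V° renV π N
  ≾V°-ren {L = L} {N} s π ρ =
    ≾V-up-to-≈ (subV-renV ρ π _ (λ i → ≈V-refl _) L) (s _) (subV-renV ρ π _ (λ i → ≈V-refl _) N)

module HoweProperties (Sig : Signature) (𝕋 : ContMonad Sig) (Γ : Relators.RelLift Sig 𝕋)
  (isRelator : Relators.IsRelator Sig 𝕋 Γ) (isInductive : Relators.IsInductive Sig 𝕋 Γ)
  (respectsΣ : Relators.RespectsΣ Sig 𝕋 Γ) where
  open Syntax Sig
  open Semantics Sig 𝕋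
  open Similarity Sig 𝕋 Γ
  open DenotationEquations Sig 𝕋
  open SimilarityProperties Sig 𝕋 Γ isRelator isInductive respectsΣ
  open Relators.IsRelator isRelator
  open Relators.IsInductive isInductive

  howe-var : ∀ {n} (x : Fin n) → HoweV n (var x) (var x)
  howe-var x = howeV (c-var x) (≾V°-refl (var x))

  howeV-≾° : ∀ {n} {V U W : Val n} → HoweV n V U → U ≾V° W → HoweV n V W
  howeV-≾° {U = U} {W} (howeV {L = L} c s) t = howeV c (≾V°-trans {U = L} {U} {W} s t)

  howeV-≾ : ∀ {V U W : Val 0} → HoweV 0 V U → U ≾V W → HoweV 0 V W
  howeV-≾ h s = howeV-≾° h (≾V⇒≾V° s)

  mutual
    howeT-ren : ∀ {n m} (π : Fin n → Fin m) {M M'} → HoweT n M M' → HoweT m (renT π M) (renT π M')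
    howeT-ren π (howeT {L = L} {N = N} (c-ret v) s) =
      howeT (c-ret (howeV-ren π v)) (≾T°-ren {L = L} {N} s π)
    howeT-ren π (howeT {L = L} {N = N} (c-app v w) s) =
      howeT (c-app (howeV-ren π v) (howeV-ren π w)) (≾T°-ren {L = L} {N} s π)
    howeT-ren π (howeT {L = L} {N = N} (c-to h k) s) =
      howeT (c-to (howeT-ren π h) (howeT-ren (ext π) k)) (≾T°-ren {L = L} {N} s π)
    howeT-ren π (howeT {L = L} {N = N} (c-op o hs) s) =
      howeT (c-op o (λ i → howeT-ren π (hs i))) (≾T°-ren {L = L} {N} s π)

    howeV-ren : ∀ {n m} (π : Fin n → Fin m) {V V'} → HoweV n V V' → HoweV m (renV π V) (renV π V')
    howeV-ren π (howeV {L = L} {W = W} (c-var x) s) =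
      howeV (c-var (π x)) (≾V°-ren {L = L} {W} s π)
    howeV-ren π (howeV {L = L} {W = W} (c-lam h) s) =
      howeV (c-lam (howeT-ren (ext π) h)) (≾V°-ren {L = L} {W} s π)

  _≾ᴴS_ : ∀ {n m} → (Fin n → Val m) → (Fin n → Val m) → Set₁
  _≾ᴴS_ {m = m} σ σ' = ∀ i → HoweV m (σ i) (σ' i)

  exts-howe : ∀ {n m} {σ σ' : Fin n → Val m} → σ ≾ᴴS σ' → exts σ ≾ᴴS exts σ'
  exts-howe h zero    = howe-var zero
  exts-howe h (suc i) = howeV-ren suc (h i)

  mutual
    howeT-sub : ∀ {n m} {σ σ' : Fin n → Val m} → σ ≾ᴴS σ' →
                ∀ {M M'} → HoweT n M M' → HoweT m (subT σ M) (subT σ' M')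
    howeT-sub {σ' = σ'} h (howeT {L = L} {N = N} (c-ret v) s) =
      howeT (c-ret (howeV-sub h v)) (≾T°-sub {L = L} {N} s σ')
    howeT-sub {σ' = σ'} h (howeT {L = L} {N = N} (c-app v w) s) =
      howeT (c-app (howeV-sub h v) (howeV-sub h w)) (≾T°-sub {L = L} {N} s σ')
    howeT-sub {σ' = σ'} h (howeT {L = L} {N = N} (c-to a b) s) =
      howeT (c-to (howeT-sub h a) (howeT-sub (exts-howe h) b)) (≾T°-sub {L = L} {N} s σ')
    howeT-sub {σ' = σ'} h (howeT {L = L} {N = N} (c-op o hs) s) =
      howeT (c-op o (λ i → howeT-sub h (hs i))) (≾T°-sub {L = L} {N} s σ')

    howeV-sub : ∀ {n m} {σ σ' : Fin n → Val m} → σ ≾ᴴS σ' →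
                ∀ {V V'} → HoweV n V V' → HoweV m (subV σ V) (subV σ' V')
    howeV-sub {σ' = σ'} h (howeV {L = L} {W = W} (c-var x) s) =
      howeV-≾° (h x) (≾V°-sub {L = L} {W} s σ')
    howeV-sub {σ' = σ'} h (howeV {L = L} {W = W} (c-lam a) s) =
      howeV (c-lam (howeT-sub (exts-howe h) a)) (≾V°-sub {L = L} {W} s σ')

  howe-[] : ∀ {M M' : Tm 1} {V W : Val 0} → HoweT 1 M M' → HoweV 0 V W → HoweT 0 (M [ V ]) (M' [ W ])
  howe-[] m v = howeT-sub (λ { zero → v }) m

  -- The step closing each case of the key lemma: a Γ(≾ᴴ)-link from X to the
  -- denotation of L extends along L ≾ N, using Γ(≾ᴴ) ; Γ(≾) ⊆ Γ(≾ᴴ ; ≾) ⊆ Γ(≾ᴴ).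
  extend-along-≾ : ∀ {X u L N} → Γ (HoweV 0) X u → u ≡ ⟦ L ⟧ → L ≾T N → Γ (HoweV 0) X ⟦ N ⟧
  extend-along-≾ x refl s =
    rel-mono _ _ (λ { (_ , h , t) → howeV-≾ h t }) (rel-comp (HoweV 0) _≾V_ (_ , x , ≾T⇒Γ s))

  howe-⇓ : ∀ {M N n X} → HoweT 0 M N → M ⇓[ n ] X → Γ (HoweV 0) X ⟦ N ⟧
  howe-⇓ h ⇓zero = ind-⊥ _ _
  howe-⇓ (howeT (c-ret {W = W} v) s) ⇓ret =
    extend-along-≾ (rel-η _ v) (sym (⟦ret⟧ W)) (≾T°⇒≾T s)
  howe-⇓ (howeT (c-app {W' = W} (howeV {W = V₁} (c-lam {N = M'} m) s') w) s) (⇓app d) =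
    extend-along-≾ (howe-⇓ (howe-[] m w) d) (sym (⟦app⟧ M' W))
      (≾T-trans (≾V-app (≾V°⇒≾V {lam M'} {V₁} s') W) (≾T°⇒≾T s))
  howe-⇓ (howeT (c-to {M' = M'} {N' = N'} m k) s) (⇓to d e) =
    extend-along-≾
      (rel-bind (HoweV 0) (HoweV 0) _ (λ W → ⟦ N' [ W ] ⟧)
        (λ {V} v → howe-⇓ (howe-[] k v) (e V)) (howe-⇓ m d))
      (sym (⟦to⟧ M' N')) (≾T°⇒≾T s)
  howe-⇓ (howeT (c-op o {Ns = Ns} ms) s) (⇓op ds) =
    extend-along-≾ (respectsΣ _ o _ _ (λ i → howe-⇓ (ms i) (ds i))) (sym (⟦op⟧ o Ns)) (≾T°⇒≾T s)

mainTheorem3 : (Sig : Signature) (𝕋 : ContMonad Sig) (Γ : Relators.RelLift Sig 𝕋) →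
    Relators.IsRelator Sig 𝕋 Γ → Relators.IsInductive Sig 𝕋 Γ → Relators.RespectsΣ Sig 𝕋 Γ →
    (M N : Syntax.Tm Sig 0) (n : ℕ) (X : ContMonad.T 𝕋 (Syntax.Val Sig 0)) →
    Similarity.HoweT Sig 𝕋 Γ 0 M N →
    Semantics._⇓[_]_ Sig 𝕋 M n X →
    Γ (Similarity.HoweV Sig 𝕋 Γ 0) X (Semantics.⟦_⟧ Sig 𝕋 N)
mainTheorem3 Sig 𝕋 Γ isRelator isInductive respectsΣ M N n X howe eval =
  HoweProperties.howe-⇓ Sig 𝕋 Γ isRelator isInductive respectsΣ howe eval
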